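{- For every prime $p$ and all $k,n\in\mathbb{N}$, $$\dim_{\mathbb{Z}/p\mathbb{Z}}(\mathcal{H}^n)=\operatorname{rank}_{\mathbb{Z}/p\mathbb{Z}}(\mathcal{A}^*_{p^k,n})\leq \binom{p^k-1+n}{n}.$$
   Context: Let $p$ be prime, $k\in\mathbb{N}$, $R=\mathbb{Z}/p^k\mathbb{Z}$. For $x,y\in R^n$, $\langle x,y\rangle=x_1y_1+\dots+x_ny_n\in R$. Let $\mathbb{S}^{n-1}(R)$ be the set of vectors in $R^n$ having at least one coordinate invertible in $R$, and let the set of (nondegenerate) directions be $\mathbb{P}R^{n-1}=\mathbb{S}^{n-1}(R)/R^\times$, i.e. $b\sim\lambda b$ for $\lambda\in R^\times$. For $a\in R^n$ and a direction $b$, the (affine) hyperplane is $H_b(a)=\{x\in R^n:\langle x-a,b\rangle=0 \text{ in } R\}$ (independent of the representative of $b$). $\mathcal{H}^n$ is the linear span over $\mathbb{Z}/p\mathbb{Z}$ of the indicator functions $\mathbf{1}_{H_b(a)}:R^n\to\mathbb{Z}/p\mathbb{Z}$, $a\in R^n$, $b\in\mathbb{P}R^{n-1}$. The reduced point-affine hyperplane incidence matrix $\mathcal{A}^*_{p^k,n}$ has rows indexed by pairs $(a,b)\in R^n\times\mathbb{P}R^{n-1}$, columns indexed by $x\in R^n$, and entry $1$ if $x\in H_b(a)$ and $0$ otherwise; its rank is taken over $\mathbb{Z}/p\mathbb{Z}$. -}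

module Defs where

open import Data.Nat as ℕ using (ℕ; zero; suc; _^_)
open import Data.Integer as ℤ using (ℤ; +_; _-_; _*_; _+_)
open import Data.Integer.Divisibility.Signed using (_∣_; _∣?_)
open import Data.Fin using (Fin; toℕ; zero; suc)
open import Data.Product using (Σ; ∃; _×_; _,_; proj₁)
open import Relation.Nullary using (¬_; yes; no)

∑ : ∀ {m} → (Fin m → ℤ) → ℤ
∑ {zero}  f = + 0
∑ {suc m} f = f zero + ∑ (λ i → f (suc i))

_≡[_]_ : ℤ → ℕ → ℤ → Set
a ≡[ q ] b = (+ q) ∣ (a - b)

ι : ∀ {q} → Fin q → ℤ
ι i = + toℕ i

-- The ring R = ℤ/p^kℤ, modelled by the residues Fin (p^k); all ring
-- equalities are checked as congruences modulo p^k in ℤ.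

R : ℕ → ℕ → Set
R p k = Fin (p ^ k)

Pt : ℕ → ℕ → ℕ → Set
Pt p k n = Fin n → R p k

IsUnit : (p k : ℕ) → R p k → Set
IsUnit p k r = ∃ λ (s : R p k) → (ι r * ι s) ≡[ p ^ k ] (+ 1)

InS : (p k n : ℕ) → Pt p k n → Set
InS p k n b = ∃ λ i → IsUnit p k (b i)

-- Canonical representative of a class in 𝕊^{n-1}(R)/R^×: the first
-- invertible coordinate equals 1.  Every class contains exactly one such
-- vector, so the type below is a model of ℙR^{n-1}.
Normalized : (p k n : ℕ) → Pt p k n → Set
Normalized p k n b =
  ∃ λ (i : Fin n) →
    (∀ (j : Fin n) → toℕ j ℕ.< toℕ i → ¬ IsUnit p k (b j))
    × (ι (b i) ≡[ p ^ k ] (+ 1))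

Direction : ℕ → ℕ → ℕ → Set
Direction p k n = Σ (Pt p k n) (Normalized p k n)

InHyp : (p k n : ℕ) → Pt p k n → Pt p k n → Pt p k n → Set
InHyp p k n a b x = ∑ (λ i → (ι (x i) - ι (a i)) * ι (b i)) ≡[ p ^ k ] (+ 0)

𝟏H : (p k n : ℕ) → Pt p k n → Pt p k n → Pt p k n → ℤ
𝟏H p k n a b x with (+ (p ^ k)) ∣? (∑ (λ i → (ι (x i) - ι (a i)) * ι (b i)) - (+ 0))
... | yes _ = + 1
... | no  _ = + 0

-- Linear algebra over ℤ/pℤ.  A vector of (ℤ/pℤ)^X is a function X → ℤ,
-- two such being equal iff they agree pointwise modulo p; scalars are
-- integers modulo p.

LinIndep : (p : ℕ) {X : Set} {m : ℕ} → (Fin m → X → ℤ) → Set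
LinIndep p {X} {m} v =
  ∀ (c : Fin m → ℤ) →
    (∀ (x : X) → ∑ (λ i → c i * v i x) ≡[ p ] (+ 0)) →
    ∀ (i : Fin m) → c i ≡[ p ] (+ 0)

InSpan : (p : ℕ) {X : Set} {m : ℕ} → (Fin m → X → ℤ) → (X → ℤ) → Set
InSpan p {X} {m} v f =
  ∃ λ (c : Fin m → ℤ) → ∀ (x : X) → f x ≡[ p ] ∑ (λ i → c i * v i x)

IsDim : (p : ℕ) {X : Set} → ((X → ℤ) → Set) → ℕ → Set
IsDim p {X} S d =
  ∃ λ (v : Fin d → X → ℤ) →
    (∀ i → S (v i)) × LinIndep p v × (∀ f → S f → InSpan p v f)

HasRank : (p : ℕ) {Row X : Set} → (Row → X → ℤ) → ℕ → Set
HasRank p {Row} {X} A r =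
  (∃ λ (rows : Fin r → Row) → LinIndep p (λ i → A (rows i)))
  × (∀ (m : ℕ) (rows : Fin m → Row) →
       LinIndep p (λ i → A (rows i)) → m ℕ.≤ r)

𝓗 : (p k n : ℕ) → (Pt p k n → ℤ) → Set
𝓗 p k n f =
  ∃ λ (m : ℕ) → ∃ λ (a : Fin m → Pt p k n) → ∃ λ (b : Fin m → Direction p k n) →
    ∃ λ (c : Fin m → ℤ) →
      ∀ x → f x ≡[ p ] ∑ (λ i → c i * 𝟏H p k n (a i) (proj₁ (b i)) x)

𝒜* : (p k n : ℕ) → (Pt p k n × Direction p k n) → Pt p k n → ℤ
𝒜* p k n (a , b) x = 𝟏H p k n a (proj₁ b) x

module Submission where

-- Write q = p^k. The indicator of H_b(a) at x is φ(⟨x,b⟩ + (q - 1)⟨a,b⟩), where φ is the indicator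
-- function of qℕ. Since φ has period q and p divides C(q, j) for 0 < j < q, Newton's forward-difference
-- formula gives Δ^q φ ≡ 0 (mod p): modulo p, φ is a polynomial of degree at most q - 1, and so is its
-- composite with any linear form. Hence every row of 𝒜* lies in the span of the C(q - 1 + n, n) binomial
-- monomials ∏ C(x_i, e_i) with Σ e_i ≤ q - 1. By the Steinitz exchange lemma over 𝔽_p no independent
-- family of rows is larger, so adjoining rows outside the current span must stop at a family of rows
-- that is a basis of 𝓗; its size is both dim 𝓗 and the rank of 𝒜*.

open import Data.Nat using (ℕ)
open import Data.Nat.Primality using (Prime)

module Congruence (q : ℕ) where

  open import Defs using (_≡[_]_; ∑; LinIndep; InSpan)
  open import Level using (0ℓ)
  open import Algebra.Bundles using (CommutativeRing)
  import Data.Nat as ℕ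
  import Data.Nat.Divisibility as ℕ
  open import Data.Integer as ℤ using (ℤ; +_; _-_; _*_; _+_; -_)
  import Data.Integer.Properties as ℤ
  open import Data.Integer.Divisibility.Signed
    using (_∣_; divides; ∣ᵤ⇒∣; ∣m⇒∣-m; ∣m∣n⇒∣m+n; ∣m⇒∣m*n; ∣n⇒∣m*n)
  open import Data.Integer.Tactic.RingSolver using (solve-∀)
  open import Data.Fin using (Fin; zero; suc)
  open import Data.Product using (∃; _,_; proj₁; proj₂)
  open import Function using (_∘_)
  open import Relation.Binary.PropositionalEquality using (_≡_; refl; sym; subst; cong)
  open import Relation.Binary.Structures using (IsEquivalence)

  -- A record rather than a synonym for a ≡[ q ] b, so that a and b can be inferred from it.
  infix 4 _≈_
  record _≈_ (a b : ℤ) : Set where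
    constructor ≈-intro
    field ≈-elim : a ≡[ q ] b
  open _≈_ public

  private
    via : ∀ {a b} e → a - b ≡ e → + q ∣ e → a ≈ b
    via e eq q∣e = ≈-intro (subst (+ q ∣_) (sym eq) q∣e)

  ≈-reflexive : ∀ {a b} → a ≡ b → a ≈ b
  ≈-reflexive {a} refl = via (+ 0) (ℤ.+-inverseʳ a) (divides (+ 0) refl)

  ≈-refl : ∀ {a} → a ≈ a
  ≈-refl = ≈-reflexive refl

  ≈-sym : ∀ {a b} → a ≈ b → b ≈ a
  ≈-sym {a} {b} (≈-intro q∣a-b) = via (- (a - b)) (identity a b) (∣m⇒∣-m q∣a-b)
    where identity : ∀ a b → b - a ≡ - (a - b)
          identity = solve-∀

  ≈-trans : ∀ {a b c} → a ≈ b → b ≈ c → a ≈ c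
  ≈-trans {a} {b} {c} (≈-intro d) (≈-intro e) = via ((a - b) + (b - c)) (identity a b c) (∣m∣n⇒∣m+n d e)
    where identity : ∀ a b c → a - c ≡ (a - b) + (b - c)
          identity = solve-∀

  +-cong : ∀ {a b c d} → a ≈ b → c ≈ d → a + c ≈ b + d
  +-cong {a} {b} {c} {d} (≈-intro e) (≈-intro f) = via ((a - b) + (c - d)) (identity a b c d) (∣m∣n⇒∣m+n e f)
    where identity : ∀ a b c d → (a + c) - (b + d) ≡ (a - b) + (c - d)
          identity = solve-∀

  -‿cong : ∀ {a b} → a ≈ b → - a ≈ - b
  -‿cong {a} {b} (≈-intro e) = via (- (a - b)) (identity a b) (∣m⇒∣-m e)
    where identity : ∀ a b → (- a) - (- b) ≡ - (a - b)
          identity = solve-∀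

  *-cong : ∀ {a b c d} → a ≈ b → c ≈ d → a * c ≈ b * d
  *-cong {a} {b} {c} {d} (≈-intro e) (≈-intro f) =
    via (a * (c - d) + (a - b) * d) (identity a b c d) (∣m∣n⇒∣m+n (∣n⇒∣m*n a f) (∣m⇒∣m*n d e))
    where identity : ∀ a b c d → (a * c) - (b * d) ≡ a * (c - d) + (a - b) * d
          identity = solve-∀

  +-congˡ : ∀ a {b c} → b ≈ c → a + b ≈ a + c
  +-congˡ a = +-cong (≈-refl {a})

  +-congʳ : ∀ a {b c} → b ≈ c → b + a ≈ c + a
  +-congʳ a b≈c = +-cong b≈c (≈-refl {a})

  *-congˡ : ∀ a {b c} → b ≈ c → a * b ≈ a * c
  *-congˡ a = *-cong (≈-refl {a})

  *-congʳ : ∀ a {b c} → b ≈ c → b * a ≈ c * a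
  *-congʳ a b≈c = *-cong b≈c (≈-refl {a})

  ∣⇒≈0 : ∀ {x} → q ℕ.∣ x → + x ≈ + 0
  ∣⇒≈0 {x} q∣x = ≈-intro (subst (+ q ∣_) (sym (ℤ.+-identityʳ (+ x))) (∣ᵤ⇒∣ q∣x))

  multiple≈0 : ∀ z → z * + q ≈ + 0
  multiple≈0 z = via (z * + q) (ℤ.+-identityʳ (z * + q)) (divides z refl)

  ≈-isEquivalence : IsEquivalence _≈_
  ≈-isEquivalence = record { refl = ≈-refl ; sym = ≈-sym ; trans = ≈-trans }

  ℤ/qℤ : CommutativeRing 0ℓ 0ℓ
  ℤ/qℤ = record
    { Carrier = ℤ ; _≈_ = _≈_ ; _+_ = _+_ ; _*_ = _*_ ; -_ = -_ ; 0# = + 0 ; 1# = + 1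
    ; isCommutativeRing = record
      { isRing = record
        { +-isAbelianGroup = record
          { isGroup = record
            { isMonoid = record
              { isSemigroup = record
                { isMagma = record { isEquivalence = ≈-isEquivalence ; ∙-cong = +-cong }
                ; assoc = λ a b c → ≈-reflexive (ℤ.+-assoc a b c) }
              ; identity = (λ a → ≈-reflexive (ℤ.+-identityˡ a)) , (λ a → ≈-reflexive (ℤ.+-identityʳ a)) }
            ; inverse = (λ a → ≈-reflexive (ℤ.+-inverseˡ a)) , (λ a → ≈-reflexive (ℤ.+-inverseʳ a))
            ; ⁻¹-cong = -‿cong }
          ; comm = λ a b → ≈-reflexive (ℤ.+-comm a b) }
        ; *-cong = *-cong
        ; *-assoc = λ a b c → ≈-reflexive (ℤ.*-assoc a b c)
        ; *-identity = (λ a → ≈-reflexive (ℤ.*-identityˡ a)) , (λ a → ≈-reflexive (ℤ.*-identityʳ a))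
        ; distrib = (λ a b c → ≈-reflexive (ℤ.*-distribˡ-+ a b c)) , (λ a b c → ≈-reflexive (ℤ.*-distribʳ-+ a b c)) }
      ; *-comm = λ a b → ≈-reflexive (ℤ.*-comm a b) } }

  open CommutativeRing ℤ/qℤ public using (setoid)
  open import Algebra.Properties.Semiring.Sum (CommutativeRing.semiring ℤ/qℤ) public
    using (sum; sum-syntax; sum-cong-≋; sum-cong-≗; sum-replicate-zero; ∑-distrib-+; ∑-comm; sum-remove; *-distribˡ-sum; *-distribʳ-sum)
  open import Relation.Binary.Reasoning.Setoid setoid

  ∑≡sum : ∀ {m} (f : Fin m → ℤ) → ∑ f ≡ sum f
  ∑≡sum {ℕ.zero} f = refl
  ∑≡sum {ℕ.suc m} f = cong (λ s → f zero + s) (∑≡sum (f ∘ suc))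

  module _ {X : Set} where

    infix 4 _∈⟨_⟩
    _∈⟨_⟩ : ∀ {m} → (X → ℤ) → (Fin m → X → ℤ) → Set
    _∈⟨_⟩ {m} f v = ∃ λ (c : Fin m → ℤ) → ∀ x → f x ≈ ∑[ i < m ] (c i * v i x)

    Independent : ∀ {m} → (Fin m → X → ℤ) → Set
    Independent {m} v = ∀ (c : Fin m → ℤ) → (∀ x → ∑[ i < m ] (c i * v i x) ≈ + 0) → ∀ i → c i ≈ + 0

    ∈⟨⟩-trans : ∀ {m r} {f} {u : Fin m → X → ℤ} {w : Fin r → X → ℤ} →
                f ∈⟨ u ⟩ → (∀ i → u i ∈⟨ w ⟩) → f ∈⟨ w ⟩
    ∈⟨⟩-trans {m} {r} {f} {u} {w} (c , f≈cu) u∈w = (λ j → ∑[ i < m ] (c i * d i j)) , λ x → begin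
      f x                                            ≈⟨ f≈cu x ⟩
      ∑[ i < m ] (c i * u i x)                       ≈⟨ sum-cong-≋ (λ i → *-congˡ (c i) (proj₂ (u∈w i) x)) ⟩
      ∑[ i < m ] (c i * ∑[ j < r ] (d i j * w j x))  ≈⟨ sum-cong-≋ (λ i → *-distribˡ-sum (c i) (λ j → d i j * w j x)) ⟩
      ∑[ i < m ] ∑[ j < r ] (c i * (d i j * w j x))  ≈⟨ ∑-comm (λ i j → c i * (d i j * w j x)) ⟩
      ∑[ j < r ] ∑[ i < m ] (c i * (d i j * w j x))
        ≈⟨ sum-cong-≋ (λ j → sum-cong-≋ (λ i → ≈-reflexive (sym (ℤ.*-assoc (c i) (d i j) (w j x))))) ⟩
      ∑[ j < r ] ∑[ i < m ] (c i * d i j * w j x)    ≈⟨ sum-cong-≋ (λ j → ≈-sym (*-distribʳ-sum (w j x) (λ i → c i * d i j))) ⟩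
      ∑[ j < r ] (∑[ i < m ] (c i * d i j) * w j x)  ∎
      where d : Fin m → Fin r → ℤ
            d i = proj₁ (u∈w i)

    Independent⇒LinIndep : ∀ {m} {v : Fin m → X → ℤ} → Independent v → LinIndep q v
    Independent⇒LinIndep {v = v} indep c h =
      λ i → ≈-elim (indep c (λ x → ≈-intro (subst (λ s → s ≡[ q ] (+ 0)) (∑≡sum (λ i → c i * v i x)) (h x))) i)

    LinIndep⇒Independent : ∀ {m} {v : Fin m → X → ℤ} → LinIndep q v → Independent v
    LinIndep⇒Independent {v = v} indep c h =
      λ i → ≈-intro (indep c (λ x → subst (λ s → s ≡[ q ] (+ 0)) (sym (∑≡sum (λ i → c i * v i x))) (≈-elim (h x))) i)

    ∈⟨⟩⇒InSpan : ∀ {m} {v : Fin m → X → ℤ} {f} → f ∈⟨ v ⟩ → InSpan q v f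
    ∈⟨⟩⇒InSpan {v = v} {f} (c , h) =
      c , λ x → subst (λ s → f x ≡[ q ] s) (sym (∑≡sum (λ i → c i * v i x))) (≈-elim (h x))

    ∈⟨⟩-resp : ∀ {m} {v : Fin m → X → ℤ} {f g} → (∀ x → f x ≡ g x) → f ∈⟨ v ⟩ → g ∈⟨ v ⟩
    ∈⟨⟩-resp f≡g (c , f≈cv) = c , λ x → ≈-trans (≈-reflexive (sym (f≡g x))) (f≈cv x)

    InSpan⇒∈⟨⟩ : ∀ {m} {v : Fin m → X → ℤ} {f} → InSpan q v f → f ∈⟨ v ⟩
    InSpan⇒∈⟨⟩ {v = v} {f} (c , h) =
      c , λ x → ≈-intro (subst (λ s → f x ≡[ q ] s) (∑≡sum (λ i → c i * v i x)) (h x))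

  ∈⟨⟩-∘ : ∀ {X Y : Set} {m} {v : Fin m → X → ℤ} {f} (h : Y → X) → f ∈⟨ v ⟩ → (f ∘ h) ∈⟨ (λ i → v i ∘ h) ⟩
  ∈⟨⟩-∘ h (c , f≈cv) = c , f≈cv ∘ h

module Binomial where

  open import Data.Nat using (ℕ; zero; suc; _+_; _*_; _^_; _∸_; _<_)
  open import Data.Nat.Properties
    using (*-comm; *-zeroʳ; *-identityˡ; *-identityʳ; m∸n+n≡m; +-comm; m^n>0; <⇒≱)
  open import Data.Nat.Divisibility using (_∣_; _∣?_; divides; ∣-trans; m∣m*n; 1∣_; *-monoʳ-∣; *-cancelˡ-∣; ∣⇒≤)
  open import Data.Nat.Primality using (Prime; euclidsLemma; prime⇒nonZero)
  open import Data.Nat.Combinatorics using (_C_; nCk+nC[k+1]≡[n+1]C[k+1]; nC1≡n)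
  open import Data.Nat.Tactic.RingSolver using (solve-∀)
  open import Data.Empty using (⊥-elim)
  open import Data.Sum using (inj₁; inj₂)
  open import Relation.Nullary using (¬_; yes; no)
  open import Relation.Binary.PropositionalEquality using (_≡_; refl; sym; trans; cong; cong₂; subst; module ≡-Reasoning)

  [1+k]*[1+n]C[1+k]≡[1+n]*nCk : ∀ n k → suc k * (suc n C suc k) ≡ suc n * (n C k)
  [1+k]*[1+n]C[1+k]≡[1+n]*nCk zero zero = refl
  [1+k]*[1+n]C[1+k]≡[1+n]*nCk zero (suc k) = *-zeroʳ (suc (suc k))
  [1+k]*[1+n]C[1+k]≡[1+n]*nCk (suc n) zero = begin
    1 * (suc (suc n) C 1)      ≡⟨ *-identityˡ (suc (suc n) C 1) ⟩
    suc (suc n) C 1            ≡⟨ nC1≡n (suc (suc n)) ⟩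
    suc (suc n)                ≡⟨ *-identityʳ (suc (suc n)) ⟨
    suc (suc n) * (suc n C 0)  ∎
    where open ≡-Reasoning
  [1+k]*[1+n]C[1+k]≡[1+n]*nCk (suc n) (suc k) = begin
    suc (suc k) * (suc (suc n) C suc (suc k))           ≡⟨ cong (suc (suc k) *_) (nCk+nC[k+1]≡[n+1]C[k+1] (suc n) (suc k)) ⟨
    suc (suc k) * (a + b)                               ≡⟨ expand a b k ⟩
    suc k * a + a + suc (suc k) * b                     ≡⟨ cong₂ (λ u v → u + a + v) ([1+k]*[1+n]C[1+k]≡[1+n]*nCk n k)
                                                                                       ([1+k]*[1+n]C[1+k]≡[1+n]*nCk n (suc k)) ⟩
    suc n * (n C k) + a + suc n * (n C suc k)           ≡⟨ collect (suc n) (n C k) (n C suc k) a ⟩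
    suc n * (n C k + n C suc k) + a                     ≡⟨ cong (λ c → suc n * c + a) (nCk+nC[k+1]≡[n+1]C[k+1] n k) ⟩
    suc n * a + a                                       ≡⟨ +-comm (suc n * a) a ⟩
    suc (suc n) * a                                     ∎
    where
    open ≡-Reasoning
    a b : ℕ
    a = suc n C suc k
    b = suc n C suc (suc k)
    expand : ∀ a b k → suc (suc k) * (a + b) ≡ suc k * a + a + suc (suc k) * b
    expand = solve-∀
    collect : ∀ m a b c → m * a + c + m * b ≡ m * (a + b) + c
    collect = solve-∀

  module _ {p : ℕ} (prime : Prime p) where

    private instance _ = prime⇒nonZero prime

    p^k∣j*b∧p∤b⇒p^k∣j : ∀ k {j b} → ¬ p ∣ b → p ^ k ∣ j * b → p ^ k ∣ j
    p^k∣j*b∧p∤b⇒p^k∣j zero    {j}     p∤b _ = 1∣ j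
    p^k∣j*b∧p∤b⇒p^k∣j (suc k) {j} {b} p∤b p^[1+k]∣jb
      with euclidsLemma j b prime (∣-trans (m∣m*n (p ^ k)) p^[1+k]∣jb)
    ... | inj₂ p∣b = ⊥-elim (p∤b p∣b)
    ... | inj₁ (divides j′ refl) = subst (p * p ^ k ∣_) (*-comm p j′) (*-monoʳ-∣ p p^k∣j′)
      where
      reassoc : ∀ j p b → j * p * b ≡ p * (j * b)
      reassoc = solve-∀
      p^k∣j′ : p ^ k ∣ j′
      p^k∣j′ = p^k∣j*b∧p∤b⇒p^k∣j k p∤b (*-cancelˡ-∣ p (subst (p * p ^ k ∣_) (reassoc j′ p b) p^[1+k]∣jb))

    -- By absorption j·C(p^k, j) = p^k·C(p^k - 1, j - 1); were p ∤ C(p^k, j), then p^k ∣ j < p^k.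
    p∣[p^k]Cj : ∀ k j → 0 < j → j < p ^ k → p ∣ (p ^ k) C j
    p∣[p^k]Cj k (suc j) _ j<p^k with p ∣? (p ^ k) C suc j
    ... | yes p∣C = p∣C
    ... | no  p∤C = ⊥-elim (<⇒≱ j<p^k (∣⇒≤ (p^k∣j*b∧p∤b⇒p^k∣j k p∤C p^k∣[1+j]*C)))
      where
      p^k≡1+r : p ^ k ≡ suc (p ^ k ∸ 1)
      p^k≡1+r = trans (sym (m∸n+n≡m (m^n>0 p k))) (+-comm (p ^ k ∸ 1) 1)
      p^k∣[1+j]*C : p ^ k ∣ suc j * ((p ^ k) C suc j)
      p^k∣[1+j]*C rewrite p^k≡1+r =
        subst (suc (p ^ k ∸ 1) ∣_) (sym ([1+k]*[1+n]C[1+k]≡[1+n]*nCk (p ^ k ∸ 1) j)) (m∣m*n _)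

module FiniteDifferences where

  open import Data.Nat as ℕ using (ℕ; zero; suc; _<_; s≤s)
  import Data.Nat.Properties as ℕ
  open import Data.Nat.Combinatorics using (_C_; nCk+nC[k+1]≡[n+1]C[k+1]; nCn≡1)
  import Data.Nat.Tactic.RingSolver as ℕSolver
  open import Data.Integer as ℤ using (ℤ; +_; _-_; _*_; _+_)
  import Data.Integer.Properties as ℤ
  open import Data.Integer.Tactic.RingSolver using (solve-∀)
  open import Data.Fin using (toℕ)
  open import Data.Fin.Properties using (toℕ<n)
  import Algebra.Properties.Semiring.Sum as SemiringSum
  open import Relation.Binary.PropositionalEquality using (_≡_; refl; sym; trans; cong; cong₂; module ≡-Reasoning)

  private module ℤΣ = SemiringSum ℤ.+-*-semiring

  Σ< : ℕ → (ℕ → ℤ) → ℤ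
  Σ< n f = ℤΣ.sum {n} (λ j → f (toℕ j))

  Σ<-last : ∀ n f → Σ< (suc n) f ≡ Σ< n f + f n
  Σ<-last zero    f = trans (ℤ.+-identityʳ (f 0)) (sym (ℤ.+-identityˡ (f 0)))
  Σ<-last (suc n) f = trans (cong (λ s → f 0 + s) (Σ<-last n (λ j → f (suc j)))) (sym (ℤ.+-assoc (f 0) _ _))

  Σ<-cong : ∀ n {f g} → (∀ j → f j ≡ g j) → Σ< n f ≡ Σ< n g
  Σ<-cong n f≗g = ℤΣ.sum-cong-≗ {n} (λ j → f≗g (toℕ j))

  Δ : ℕ → (ℕ → ℤ) → ℕ → ℤ
  Δ c ψ t = ψ (t ℕ.+ c) - ψ t

  private
    t+[1+c]≡t+c+1 : ∀ t c → t ℕ.+ suc c ≡ t ℕ.+ c ℕ.+ 1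
    t+[1+c]≡t+c+1 t c = trans (ℕ.+-suc t c) (ℕ.+-comm 1 (t ℕ.+ c))

  Δ^ : ℕ → (ℕ → ℤ) → ℕ → ℤ
  Δ^ zero    ψ = ψ
  Δ^ (suc j) ψ = Δ^ j (Δ 1 ψ)

  Δ^-cong : ∀ j {ψ φ : ℕ → ℤ} → (∀ t → ψ t ≡ φ t) → ∀ t → Δ^ j ψ t ≡ Δ^ j φ t
  Δ^-cong zero    ψ≗φ = ψ≗φ
  Δ^-cong (suc j) ψ≗φ = Δ^-cong j (λ t → cong₂ _-_ (ψ≗φ (t ℕ.+ 1)) (ψ≗φ t))

  Δ-comm : ∀ c d ψ t → Δ d (Δ c ψ) t ≡ Δ c (Δ d ψ) t
  Δ-comm c d ψ t = trans (cong (λ s → (ψ s - ψ (t ℕ.+ d)) - (ψ (t ℕ.+ c) - ψ t)) (swap t c d))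
                         (exchange (ψ (t ℕ.+ c ℕ.+ d)) (ψ (t ℕ.+ d)) (ψ (t ℕ.+ c)) (ψ t))
    where
    exchange : ∀ a b c d → (a - b) - (c - d) ≡ (a - c) - (b - d)
    exchange = solve-∀
    swap : ∀ t c d → t ℕ.+ d ℕ.+ c ≡ t ℕ.+ c ℕ.+ d
    swap = ℕSolver.solve-∀

  Δ^-Δ-comm : ∀ j c ψ t → Δ^ j (Δ c ψ) t ≡ Δ c (Δ^ j ψ) t
  Δ^-Δ-comm zero    c ψ t = refl
  Δ^-Δ-comm (suc j) c ψ t = trans (Δ^-cong j (Δ-comm c 1 ψ) t) (Δ^-Δ-comm j c (Δ 1 ψ) t)

  Δ-telescope : ∀ c ψ t → Δ c ψ t ≡ Σ< c (λ i → Δ 1 ψ (t ℕ.+ i))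
  Δ-telescope zero    ψ t = trans (cong (λ s → ψ s - ψ t) (ℕ.+-identityʳ t)) (ℤ.+-inverseʳ (ψ t))
  Δ-telescope (suc c) ψ t = begin
    ψ (t ℕ.+ suc c) - ψ t                          ≡⟨ cong (λ s → ψ s - ψ t) (t+[1+c]≡t+c+1 t c) ⟩
    ψ (t ℕ.+ c ℕ.+ 1) - ψ t                        ≡⟨ split (ψ (t ℕ.+ c ℕ.+ 1)) (ψ (t ℕ.+ c)) (ψ t) ⟩
    Δ c ψ t + Δ 1 ψ (t ℕ.+ c)                      ≡⟨ cong (λ s → s + Δ 1 ψ (t ℕ.+ c)) (Δ-telescope c ψ t) ⟩
    Σ< c (λ i → Δ 1 ψ (t ℕ.+ i)) + Δ 1 ψ (t ℕ.+ c) ≡⟨ Σ<-last c (λ i → Δ 1 ψ (t ℕ.+ i)) ⟨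
    Σ< (suc c) (λ i → Δ 1 ψ (t ℕ.+ i))             ∎
    where
    open ≡-Reasoning
    split : ∀ a b d → a - d ≡ (b - d) + (a - b)
    split = solve-∀

  newton : ∀ m N → m < N → ∀ ψ t → ψ (t ℕ.+ m) ≡ Σ< N (λ j → + (m C j) * Δ^ j ψ t)
  newton zero (suc N) _ ψ t = begin
    ψ (t ℕ.+ 0)                                              ≡⟨ cong ψ (ℕ.+-identityʳ t) ⟩
    ψ t                                                      ≡⟨ ℤ.*-identityˡ (ψ t) ⟨
    + 1 * ψ t                                                ≡⟨ ℤ.+-identityʳ _ ⟨
    + 1 * ψ t + + 0                                          ≡⟨ cong (λ s → + 1 * ψ t + s) (ℤΣ.sum-replicate-zero N) ⟨
    + 1 * ψ t + Σ< N (λ j → + (0 C suc j) * Δ^ (suc j) ψ t)  ∎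
    where open ≡-Reasoning
  newton (suc m) (suc N) (s≤s m<N) ψ t = begin
    ψ (t ℕ.+ suc m)                                   ≡⟨ cong ψ (t+[1+c]≡t+c+1 t m) ⟩
    ψ (t ℕ.+ m ℕ.+ 1)                                 ≡⟨ split (ψ (t ℕ.+ m ℕ.+ 1)) (ψ (t ℕ.+ m)) ⟩
    ψ (t ℕ.+ m) + Δ 1 ψ (t ℕ.+ m)
      ≡⟨ cong₂ _+_ (newton m (suc N) (ℕ.m≤n⇒m≤1+n m<N) ψ t) (newton m N m<N (Δ 1 ψ) t) ⟩
    (+ 1 * ψ t + Σ< N B) + Σ< N A                     ≡⟨ reassoc (+ 1 * ψ t) (Σ< N A) (Σ< N B) ⟩
    + 1 * ψ t + (Σ< N A + Σ< N B)                     ≡⟨ cong (λ s → + 1 * ψ t + s) (ℤΣ.∑-distrib-+ {N} (λ j → A (toℕ j)) (λ j → B (toℕ j))) ⟨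
    + 1 * ψ t + Σ< N (λ j → A j + B j)                ≡⟨ cong (λ s → + 1 * ψ t + s) (Σ<-cong N pascal) ⟩
    + 1 * ψ t + Σ< N (λ j → + (suc m C suc j) * Δ^ (suc j) ψ t) ∎
    where
    open ≡-Reasoning
    A B : ℕ → ℤ
    A j = + (m C j) * Δ^ (suc j) ψ t
    B j = + (m C suc j) * Δ^ (suc j) ψ t
    split : ∀ a b → a ≡ b + (a - b)
    split = solve-∀
    reassoc : ∀ x a b → (x + b) + a ≡ x + (a + b)
    reassoc = solve-∀
    pascal : ∀ j → A j + B j ≡ + (suc m C suc j) * Δ^ (suc j) ψ t
    pascal j = trans (sym (ℤ.*-distribʳ-+ (Δ^ (suc j) ψ t) (+ (m C j)) (+ (m C suc j))))
                     (cong (λ c → + c * Δ^ (suc j) ψ t) (nCk+nC[k+1]≡[n+1]C[k+1] m j))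

  module Degree (q : ℕ) where

    open Congruence q
    open import Relation.Binary.Reasoning.Setoid setoid

    Σ<-≈0 : ∀ n f → (∀ j → j < n → f j ≈ + 0) → Σ< n f ≈ + 0
    Σ<-≈0 n f f≈0 = ≈-trans (sum-cong-≋ (λ j → f≈0 (toℕ j) (toℕ<n j))) (sum-replicate-zero n)

    -- Newton's formula for m = N reads ψ (t + N) = ψ t + Σ_{0<j<N} C(N, j) Δ^j ψ t + Δ^N ψ t.
    periodic⇒Δ^period≈0 : ∀ r ψ → (∀ t → ψ (t ℕ.+ suc r) ≡ ψ t) →
                           (∀ j → j < r → + (suc r C suc j) ≈ + 0) →
                           ∀ t → Δ^ (suc r) ψ t ≈ + 0
    periodic⇒Δ^period≈0 r ψ periodic C≈0 t = begin
      Δ^ N ψ t                  ≡⟨ isolate (ψ (t ℕ.+ N)) (ψ t) S (Δ^ N ψ t) newton-at-N ⟩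
      (ψ (t ℕ.+ N) - ψ t) - S   ≡⟨ cong (λ s → (s - ψ t) - S) (periodic t) ⟩
      (ψ t - ψ t) - S           ≈⟨ +-congˡ (ψ t - ψ t) (-‿cong S≈0) ⟩
      (ψ t - ψ t) - + 0         ≡⟨ cancel (ψ t) ⟩
      + 0                       ∎
      where
      N : ℕ
      N = suc r
      g : ℕ → ℤ
      g j = + (N C suc j) * Δ^ (suc j) ψ t
      S : ℤ
      S = Σ< r g
      newton-at-N : ψ (t ℕ.+ N) ≡ + 1 * ψ t + (S + + 1 * Δ^ N ψ t)
      newton-at-N = trans (newton N (suc N) ℕ.≤-refl ψ t)
        (cong (λ s → + 1 * ψ t + s) (trans (Σ<-last r g) (cong (λ c → S + + c * Δ^ N ψ t) (nCn≡1 N))))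
      S≈0 : S ≈ + 0
      S≈0 = Σ<-≈0 r g (λ j j<r → ≈-trans (*-congʳ (Δ^ (suc j) ψ t) (C≈0 j j<r)) (≈-reflexive (ℤ.*-zeroˡ (Δ^ (suc j) ψ t))))
      isolate : ∀ a b s d → a ≡ + 1 * b + (s + + 1 * d) → d ≡ (a - b) - s
      isolate a b s d refl = solve b s d
        where solve : ∀ b s d → d ≡ ((+ 1 * b + (s + + 1 * d)) - b) - s
              solve = solve-∀
      cancel : ∀ a → (a - a) - + 0 ≡ + 0
      cancel = solve-∀

    HasDegree≤ : ℕ → (ℕ → ℤ) → Set
    HasDegree≤ zero    ψ = ∀ c t → ψ (t ℕ.+ c) ≈ ψ t
    HasDegree≤ (suc D) ψ = ∀ c → HasDegree≤ D (Δ c ψ)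

    Δ^≈0⇒HasDegree≤ : ∀ D ψ → (∀ t → Δ^ (suc D) ψ t ≈ + 0) → HasDegree≤ D ψ
    Δ^≈0⇒HasDegree≤ zero ψ Δψ≈0 c t = begin
      ψ (t ℕ.+ c)                         ≡⟨ split (ψ (t ℕ.+ c)) (ψ t) ⟩
      Δ c ψ t + ψ t                       ≡⟨ cong (_+ ψ t) (Δ-telescope c ψ t) ⟩
      Σ< c (λ i → Δ 1 ψ (t ℕ.+ i)) + ψ t  ≈⟨ +-congʳ (ψ t) (Σ<-≈0 c _ (λ i _ → Δψ≈0 (t ℕ.+ i))) ⟩
      + 0 + ψ t                           ≡⟨ ℤ.+-identityˡ (ψ t) ⟩
      ψ t                                 ∎
      where split : ∀ a b → a ≡ (a - b) + b
            split = solve-∀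
    Δ^≈0⇒HasDegree≤ (suc D) ψ Δ^ψ≈0 c = Δ^≈0⇒HasDegree≤ D (Δ c ψ) λ t → begin
      Δ^ (suc D) (Δ c ψ) t                                   ≡⟨ Δ^-Δ-comm (suc D) c ψ t ⟩
      Δ c (Δ^ (suc D) ψ) t                                   ≡⟨ Δ-telescope c (Δ^ (suc D) ψ) t ⟩
      Σ< c (λ i → Δ 1 (Δ^ (suc D) ψ) (t ℕ.+ i))              ≡⟨ Σ<-cong c (λ i → sym (Δ^-Δ-comm (suc D) 1 ψ (t ℕ.+ i))) ⟩
      Σ< c (λ i → Δ^ (suc (suc D)) ψ (t ℕ.+ i))              ≈⟨ Σ<-≈0 c _ (λ i _ → Δ^ψ≈0 (t ℕ.+ i)) ⟩
      + 0                                                    ∎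

module BinomialMonomials where

  open FiniteDifferences
  open import Data.Nat as ℕ using (ℕ; zero; suc)
  import Data.Nat.Properties as ℕ
  open import Data.Nat.Combinatorics using (_C_; nCk+nC[k+1]≡[n+1]C[k+1]; nCn≡1)
  import Data.Nat.Tactic.RingSolver as ℕSolver
  open import Data.Integer as ℤ using (ℤ; +_; _-_; _*_; _+_)
  import Data.Integer.Properties as ℤ
  open import Data.Integer.Tactic.RingSolver using (solve-∀)
  open import Data.Fin using (Fin; zero; suc; toℕ; _↑ˡ_; _↑ʳ_)
  open import Data.Vec.Functional using (_∷_; _++_; head; tail)
  open import Data.Vec.Functional.Properties using (lookup-++ˡ; lookup-++ʳ)
  import Algebra.Properties.Semiring.Sum as SemiringSum
  open import Data.Product using (_,_)
  open import Function using (_∘_)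
  open import Relation.Binary.PropositionalEquality using (_≡_; refl; sym; trans; cong; cong₂; module ≡-Reasoning)

  private module ℕΣ = SemiringSum ℕ.+-*-semiring
  private module ℤΣ = SemiringSum ℤ.+-*-semiring

  ⟨_,_⟩ : ∀ {n} → (Fin n → ℕ) → (Fin n → ℕ) → ℕ
  ⟨ y , b ⟩ = ℕΣ.sum (λ i → y i ℕ.* b i)

  binomialMonomial : ∀ {n} → (Fin n → ℕ) → (Fin n → ℕ) → ℤ
  binomialMonomial {zero}  e y = + 1
  binomialMonomial {suc n} e y = + (head y C head e) * binomialMonomial (tail e) (tail y)

  binomialMonomial-0∷ : ∀ {n} (e : Fin n → ℕ) y → binomialMonomial (0 ∷ e) y ≡ binomialMonomial e (tail y)
  binomialMonomial-0∷ e y = ℤ.*-identityˡ (binomialMonomial e (tail y))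

  -- The exponents e ∈ ℕⁿ with e₀ + ⋯ + eₙ₋₁ ≤ D, split according to e₀ = 0 or e₀ > 0.
  monomialCount : ℕ → ℕ → ℕ
  monomialCount zero    D       = 1
  monomialCount (suc n) zero    = monomialCount n zero
  monomialCount (suc n) (suc D) = monomialCount n (suc D) ℕ.+ monomialCount (suc n) D

  exponent : ∀ n D → Fin (monomialCount n D) → Fin n → ℕ
  exponent zero    D       i = λ ()
  exponent (suc n) zero    i = 0 ∷ exponent n zero i
  exponent (suc n) (suc D)   = (λ i → 0 ∷ exponent n (suc D) i) ++ (λ i → bump (exponent (suc n) D i))
    where bump : (Fin (suc n) → ℕ) → Fin (suc n) → ℕ
          bump e = suc (head e) ∷ tail e

  binomialMonomials : ∀ n D → Fin (monomialCount n D) → (Fin n → ℕ) → ℤ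
  binomialMonomials n D i = binomialMonomial (exponent n D i)

  monomialCount≡C : ∀ n D → monomialCount n D ≡ (D ℕ.+ n) C n
  monomialCount≡C zero    D       = refl
  monomialCount≡C (suc n) zero    = trans (monomialCount≡C n zero) (trans (nCn≡1 n) (sym (nCn≡1 (suc n))))
  monomialCount≡C (suc n) (suc D) = begin
    monomialCount n (suc D) ℕ.+ monomialCount (suc n) D  ≡⟨ cong₂ ℕ._+_ (monomialCount≡C n (suc D)) (monomialCount≡C (suc n) D) ⟩
    (suc D ℕ.+ n) C n ℕ.+ (D ℕ.+ suc n) C suc n          ≡⟨ cong (λ m → m C n ℕ.+ (D ℕ.+ suc n) C suc n) (ℕ.+-suc D n) ⟨
    (D ℕ.+ suc n) C n ℕ.+ (D ℕ.+ suc n) C suc n          ≡⟨ nCk+nC[k+1]≡[n+1]C[k+1] (D ℕ.+ suc n) n ⟩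
    (suc D ℕ.+ suc n) C suc n                            ∎
    where open ≡-Reasoning

  hockey-stick : ∀ y e → Σ< y (λ j → + (j C e)) ≡ + (y C suc e)
  hockey-stick zero    e = refl
  hockey-stick (suc y) e = begin
    Σ< (suc y) (λ j → + (j C e))    ≡⟨ Σ<-last y (λ j → + (j C e)) ⟩
    Σ< y (λ j → + (j C e)) + + (y C e) ≡⟨ cong (_+ + (y C e)) (hockey-stick y e) ⟩
    + (y C suc e) + + (y C e)       ≡⟨ ℤ.pos-+ (y C suc e) (y C e) ⟨
    + (y C suc e ℕ.+ y C e)         ≡⟨ cong +_ (trans (ℕ.+-comm (y C suc e) (y C e)) (nCk+nC[k+1]≡[n+1]C[k+1] y e)) ⟩
    + (suc y C suc e)               ∎
    where open ≡-Reasoning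

  sum-↑ : ∀ {a b} (F : Fin (a ℕ.+ b) → ℤ) → ℤΣ.sum F ≡ ℤΣ.sum (F ∘ (_↑ˡ b)) + ℤΣ.sum (F ∘ (a ↑ʳ_))
  sum-↑ {zero}  F = sym (ℤ.+-identityˡ (ℤΣ.sum F))
  sum-↑ {suc a} F = trans (cong (λ t → F zero + t) (sum-↑ {a} (F ∘ suc))) (sym (ℤ.+-assoc (F zero) _ _))

  sum-++ : ∀ {A : Set} {a b} (c₁ : Fin a → ℤ) (c₂ : Fin b → ℤ) (e₁ : Fin a → A) (e₂ : Fin b → A) (g : A → ℤ) →
           ℤΣ.sum (λ i → (c₁ ++ c₂) i * g ((e₁ ++ e₂) i)) ≡ ℤΣ.sum (λ i → c₁ i * g (e₁ i)) + ℤΣ.sum (λ i → c₂ i * g (e₂ i))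
  sum-++ {a = a} c₁ c₂ e₁ e₂ g = trans (sum-↑ {a} (λ i → (c₁ ++ c₂) i * g ((e₁ ++ e₂) i))) (cong₂ _+_
    (ℤΣ.sum-cong-≗ (λ i → cong₂ (λ c e → c * g e) (lookup-++ˡ c₁ c₂ i) (lookup-++ˡ e₁ e₂ i)))
    (ℤΣ.sum-cong-≗ (λ i → cong₂ (λ c e → c * g e) (lookup-++ʳ c₁ c₂ i) (lookup-++ʳ e₁ e₂ i))))

  Σ<-binomialMonomial : ∀ {n} y c (e : Fin (suc n) → ℕ) (z : Fin n → ℕ) →
    Σ< y (λ j → c * binomialMonomial e (j ∷ z)) ≡ c * binomialMonomial (suc (head e) ∷ tail e) (y ∷ z)
  Σ<-binomialMonomial y c e z = begin
    Σ< y (λ j → c * (+ (j C head e) * M))  ≡⟨ Σ<-cong y (λ j → rearrange c (+ (j C head e)) M) ⟩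
    Σ< y (λ j → (c * M) * + (j C head e))  ≡⟨ ℤΣ.*-distribˡ-sum {y} (c * M) _ ⟨
    (c * M) * Σ< y (λ j → + (j C head e))  ≡⟨ cong ((c * M) *_) (hockey-stick y (head e)) ⟩
    (c * M) * + (y C suc (head e))         ≡⟨ rearrange c (+ (y C suc (head e))) M ⟨
    c * (+ (y C suc (head e)) * M)         ∎
    where
    open ≡-Reasoning
    M : ℤ
    M = binomialMonomial (tail e) z
    rearrange : ∀ c b m → c * (b * m) ≡ (c * m) * b
    rearrange = solve-∀

  first-variable-telescope : ∀ {n} (φ : ℕ → ℤ) s (b y : Fin (suc n) → ℕ) →
    φ (s ℕ.+ ⟨ y , b ⟩) ≡ φ (s ℕ.+ ⟨ tail y , tail b ⟩) + Σ< (head y) (λ j → Δ (head b) φ (s ℕ.+ ⟨ j ∷ tail y , b ⟩))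
  first-variable-telescope φ s b y = begin
    T (head y)                                  ≡⟨ split (T (head y)) (T 0) ⟩
    T 0 + Δ (head y) T 0                        ≡⟨ cong (λ t → T 0 + t) (Δ-telescope (head y) T 0) ⟩
    T 0 + Σ< (head y) (λ j → Δ 1 T j)           ≡⟨ cong (λ t → T 0 + t) (Σ<-cong (head y) (λ j → cong (λ t → φ t - T j) (shift j))) ⟩
    T 0 + Σ< (head y) (λ j → Δ (head b) φ (s ℕ.+ (j ℕ.* head b ℕ.+ R))) ∎
    where
    open ≡-Reasoning
    R : ℕ
    R = ⟨ tail y , tail b ⟩
    T : ℕ → ℤ
    T j = φ (s ℕ.+ (j ℕ.* head b ℕ.+ R))
    split : ∀ a b → a ≡ b + (a - b)
    split = solve-∀
    shift : ∀ j → s ℕ.+ ((j ℕ.+ 1) ℕ.* head b ℕ.+ R) ≡ s ℕ.+ (j ℕ.* head b ℕ.+ R) ℕ.+ head b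
    shift j = solveShift s (head b) j R
      where solveShift : ∀ s b j r → s ℕ.+ ((j ℕ.+ 1) ℕ.* b ℕ.+ r) ≡ s ℕ.+ (j ℕ.* b ℕ.+ r) ℕ.+ b
            solveShift = ℕSolver.solve-∀

  module Spanning (q : ℕ) where

    open Congruence q
    open Degree q
    open import Relation.Binary.Reasoning.Setoid setoid

    binomialMonomials-span : ∀ n D φ → HasDegree≤ D φ → ∀ (b : Fin n → ℕ) s →
                             (λ y → φ (s ℕ.+ ⟨ y , b ⟩)) ∈⟨ binomialMonomials n D ⟩
    binomialMonomials-span zero D φ _ b s = (λ _ → φ (s ℕ.+ 0)) , λ y → ≈-reflexive (unit (φ (s ℕ.+ 0)))
      where unit : ∀ a → a ≡ a * + 1 + + 0
            unit = solve-∀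
    binomialMonomials-span (suc n) zero φ constant b s with binomialMonomials-span n zero φ constant (tail b) s
    ... | c , spanned = c , λ y → let R = ⟨ tail y , tail b ⟩ in begin
      φ (s ℕ.+ (head y ℕ.* head b ℕ.+ R))    ≡⟨ cong φ (swap s (head y ℕ.* head b) R) ⟩
      φ ((s ℕ.+ R) ℕ.+ head y ℕ.* head b)    ≈⟨ constant (head y ℕ.* head b) (s ℕ.+ R) ⟩
      φ (s ℕ.+ R)                            ≈⟨ spanned (tail y) ⟩
      ∑[ i < monomialCount n 0 ] (c i * binomialMonomials n 0 i (tail y))
        ≈⟨ sum-cong-≋ (λ i → *-congˡ (c i) (≈-reflexive (sym (binomialMonomial-0∷ (exponent n zero i) y)))) ⟩
      ∑[ i < monomialCount n 0 ] (c i * binomialMonomials (suc n) 0 i y) ∎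
      where swap : ∀ s a r → s ℕ.+ (a ℕ.+ r) ≡ (s ℕ.+ r) ℕ.+ a
            swap = ℕSolver.solve-∀
    binomialMonomials-span (suc n) (suc D) φ hasDegree b s
      with binomialMonomials-span n (suc D) φ hasDegree (tail b) s
         | binomialMonomials-span (suc n) D (Δ (head b) φ) (hasDegree (head b)) b s
    ... | c₁ , spanned₁ | c₂ , spanned₂ = c₁ ++ c₂ , spans
      where
      a b′ : ℕ
      a  = monomialCount n (suc D)
      b′ = monomialCount (suc n) D
      E₁ : Fin a → Fin (suc n) → ℕ
      E₁ i = 0 ∷ exponent n (suc D) i
      E₂ : Fin b′ → Fin (suc n) → ℕ
      E₂ i = suc (head (exponent (suc n) D i)) ∷ tail (exponent (suc n) D i)
      spans : ∀ y → φ (s ℕ.+ ⟨ y , b ⟩) ≈ ∑[ i < a ℕ.+ b′ ] ((c₁ ++ c₂) i * binomialMonomials (suc n) (suc D) i y)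
      spans y = begin
        φ (s ℕ.+ ⟨ y , b ⟩)
          ≡⟨ first-variable-telescope φ s b y ⟩
        φ (s ℕ.+ ⟨ tail y , tail b ⟩) + Σ< (head y) (λ j → Δ (head b) φ (s ℕ.+ ⟨ j ∷ tail y , b ⟩))
          ≈⟨ +-cong (spanned₁ (tail y)) (sum-cong-≋ {head y} (λ j → spanned₂ (toℕ j ∷ tail y))) ⟩
        ∑[ i < a ] (c₁ i * binomialMonomials n (suc D) i (tail y))
          + Σ< (head y) (λ j → ∑[ i < b′ ] (c₂ i * binomialMonomials (suc n) D i (j ∷ tail y)))
          ≈⟨ +-congˡ (∑[ i < a ] (c₁ i * binomialMonomials n (suc D) i (tail y)))
                     (∑-comm {head y} {b′} (λ j i → c₂ i * binomialMonomials (suc n) D i (toℕ j ∷ tail y))) ⟩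
        ∑[ i < a ] (c₁ i * binomialMonomials n (suc D) i (tail y))
          + ∑[ i < b′ ] Σ< (head y) (λ j → c₂ i * binomialMonomials (suc n) D i (j ∷ tail y))
          ≡⟨ cong₂ _+_ (ℤΣ.sum-cong-≗ {a} (λ i → cong (c₁ i *_) (sym (binomialMonomial-0∷ (exponent n (suc D) i) y))))
                       (ℤΣ.sum-cong-≗ {b′} (λ i → Σ<-binomialMonomial (head y) (c₂ i) (exponent (suc n) D i) (tail y))) ⟩
        ∑[ i < a ] (c₁ i * binomialMonomial (E₁ i) y) + ∑[ i < b′ ] (c₂ i * binomialMonomial (E₂ i) y)
          ≡⟨ sum-++ c₁ c₂ E₁ E₂ (λ e → binomialMonomial e y) ⟨
        ∑[ i < a ℕ.+ b′ ] ((c₁ ++ c₂) i * binomialMonomials (suc n) (suc D) i y) ∎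

module FiniteSearch where

  open import Data.Nat using (ℕ)
  open import Data.Fin using (Fin; finToFun; funToFin)
  open import Data.Fin.Properties using (all?; any?; finToFun-funToFin)
  open import Data.Product using (∃; _,_)
  open import Function using (_∘_)
  open import Relation.Nullary using (Dec)
  open import Relation.Nullary.Decidable using (map′)
  open import Relation.Binary.PropositionalEquality using (_≗_; sym)
  open import Relation.Binary.Definitions using (_Respects_)

  module _ {m a : ℕ} where

    all-functions? : ∀ {P : (Fin m → Fin a) → Set} → P Respects _≗_ → (∀ f → Dec (P f)) → Dec (∀ f → P f)
    all-functions? resp P? = map′ (λ all f → resp (finToFun-funToFin f) (all (funToFin f))) (λ all → all ∘ finToFun)
                                  (all? (P? ∘ finToFun))

    any-function? : ∀ {P : (Fin m → Fin a) → Set} → P Respects _≗_ → (∀ f → Dec (P f)) → Dec (∃ P)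
    any-function? resp P? = map′ (λ (i , Pi) → finToFun i , Pi) (λ (f , Pf) → funToFin f , resp (sym ∘ finToFun-funToFin f) Pf)
                                 (any? (P? ∘ finToFun))

module LinearAlgebra {p : ℕ} (prime : Prime p) where

  open import Defs using (ι; IsDim; HasRank)
  open import Data.Nat as ℕ using (ℕ; zero; suc; _≤_; _<_; z≤n; s≤s)
  import Data.Nat.Properties as ℕ
  import Data.Nat.Divisibility as ℕ
  open import Data.Nat.Primality using (Prime; prime⇒nonZero; prime⇒nonTrivial)
  open import Data.Nat.Coprimality using (prime⇒coprime; coprime-Bézout)
  open import Data.Nat.GCD using (module Bézout)
  open import Data.Integer as ℤ using (ℤ; +_; _-_; _*_; _+_; -_)
  import Data.Integer.Properties as ℤ
  open import Data.Integer.DivMod using (_/ℕ_; _%ℕ_; a≡a%ℕn+[a/ℕn]*n; n%ℕd<d)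
  open import Data.Integer.Divisibility.Signed using (_∣?_; ∣⇒∣ᵤ)
  open import Data.Integer.Tactic.RingSolver using (solve-∀)
  open import Data.Fin using (Fin; zero; suc; punchIn; fromℕ<)
  open import Data.Fin.Properties using (any?; toℕ-fromℕ<)
  open import Data.Vec.Functional using (_∷_; tail; insertAt)
  open import Data.Vec.Functional.Properties using (insertAt-lookup; insertAt-punchIn)
  open import Data.Product using (∃; _,_; proj₁; proj₂)
  open import Data.Sum using (_⊎_; inj₁; inj₂)
  open import Data.Empty using (⊥-elim)
  open import Function using (_∘_)
  open import Relation.Nullary using (¬_; Dec; yes; no)
  open import Relation.Nullary.Decidable using (map′; ¬?; decidable-stable)
  open import Relation.Binary.PropositionalEquality using (_≡_; _≗_; refl; sym; trans; cong; cong₂; subst; subst₂)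
  open import Relation.Binary.Core using (_Preserves_⟶_)
  open import Relation.Binary.Definitions using (_Respects_)
  open FiniteSearch
  open Congruence p
  open import Relation.Binary.Reasoning.Setoid setoid

  private instance _ = prime⇒nonZero prime

  ≈? : ∀ a b → Dec (a ≈ b)
  ≈? a b = map′ ≈-intro ≈-elim (+ p ∣? (a - b))

  1≉0 : ¬ (+ 1 ≈ + 0)
  1≉0 (≈-intro p∣1) with ℕ.∣1⇒≡1 (∣⇒∣ᵤ p∣1) | prime⇒nonTrivial prime
  ... | refl | ()

  ≈%ℕ : ∀ a → a ≈ + (a %ℕ p)
  ≈%ℕ a = begin
    a                               ≡⟨ a≡a%ℕn+[a/ℕn]*n a p ⟩
    + (a %ℕ p) + (a /ℕ p) * + p     ≈⟨ +-congˡ (+ (a %ℕ p)) (multiple≈0 (a /ℕ p)) ⟩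
    + (a %ℕ p) + + 0                ≡⟨ ℤ.+-identityʳ (+ (a %ℕ p)) ⟩
    + (a %ℕ p)                      ∎

  reduce : ℤ → Fin p
  reduce a = fromℕ< (n%ℕd<d a p)

  ι-reduce : ∀ a → ι (reduce a) ≈ a
  ι-reduce a = ≈-trans (≈-reflexive (cong +_ (toℕ-fromℕ< (n%ℕd<d a p)))) (≈-sym (≈%ℕ a))

  private
    ≈residue : ∀ a {r} → a %ℕ p ≡ r → a ≈ + r
    ≈residue a refl = ≈%ℕ a

    pos-identity : ∀ a b c d → 1 ℕ.+ a ℕ.* b ≡ c ℕ.* d → + 1 + + a * + b ≡ + c * + d
    pos-identity a b c d eq =
      trans (cong (λ t → + 1 + t) (sym (ℤ.pos-* a b))) (trans (sym (ℤ.pos-+ 1 (a ℕ.* b))) (trans (cong +_ eq) (ℤ.pos-* c d)))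

  -- Bézout's identity for the residue of a, which is coprime to p.
  inverse : ∀ a → ¬ a ≈ + 0 → ∃ λ α → a * α ≈ + 1
  inverse a a≉0 with a %ℕ p in a%p≡r | n%ℕd<d a p
  ... | zero  | _   = ⊥-elim (a≉0 (≈residue a a%p≡r))
  ... | suc r | r<p with coprime-Bézout (prime⇒coprime prime r<p)
  ... | Bézout.+- x y eq = (- + y) , (begin
    a * (- + y)          ≈⟨ *-congʳ (- + y) (≈residue a a%p≡r) ⟩
    + suc r * (- + y)    ≡⟨ negate (+ suc r) (+ y) (+ x) (+ p) (pos-identity y (suc r) x p eq) ⟩
    + 1 + (- + x) * + p  ≈⟨ +-congˡ (+ 1) (multiple≈0 (- + x)) ⟩
    + 1 + + 0            ∎)
    where
    negate : ∀ r y x p → + 1 + y * r ≡ x * p → r * (- y) ≡ + 1 + (- x) * p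
    negate r y x p eq = trans (expand r y) (trans (cong (λ t → + 1 - t) eq) (collect x p))
      where expand : ∀ r y → r * (- y) ≡ + 1 - (+ 1 + y * r)
            expand = solve-∀
            collect : ∀ x p → + 1 - x * p ≡ + 1 + (- x) * p
            collect = solve-∀
  ... | Bézout.-+ x y eq = + y , (begin
    a * + y              ≈⟨ *-congʳ (+ y) (≈residue a a%p≡r) ⟩
    + suc r * + y        ≡⟨ trans (ℤ.*-comm (+ suc r) (+ y)) (sym (pos-identity x p y (suc r) eq)) ⟩
    + 1 + + x * + p      ≈⟨ +-congˡ (+ 1) (multiple≈0 (+ x)) ⟩
    + 1 + + 0            ∎)

  module _ {X : Set} where

    Independent-resp : ∀ {m} {v w : Fin m → X → ℤ} → (∀ i x → v i x ≡ w i x) → Independent v → Independent w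
    Independent-resp v≡w indep c combo≈0 =
      indep c (λ x → ≈-trans (sum-cong-≋ (λ i → ≈-reflexive (cong (c i *_) (v≡w i x)))) (combo≈0 x))

    Independent-∷ : ∀ {m} {v : Fin m → X → ℤ} {f} → Independent v → ¬ f ∈⟨ v ⟩ → Independent (f ∷ v)
    Independent-∷ {m} {v} {f} indep f∉⟨v⟩ c combo≈0 = coefficient≈0
      where
      S : X → ℤ
      S x = ∑[ i < m ] (c (suc i) * v i x)
      f∈⟨v⟩ : ¬ c zero ≈ + 0 → f ∈⟨ v ⟩
      f∈⟨v⟩ c₀≉0 = (λ i → - (α * c (suc i))) , λ x → begin
        f x                                       ≡⟨ ℤ.*-identityˡ (f x) ⟨
        + 1 * f x                                 ≈⟨ *-congʳ (f x) (≈-sym c₀α≈1) ⟩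
        c zero * α * f x                          ≡⟨ isolate (c zero) α (f x) (S x) ⟩
        α * (c zero * f x + S x) + - (α * S x)    ≈⟨ +-congʳ (- (α * S x)) (*-congˡ α (combo≈0 x)) ⟩
        α * + 0 + - (α * S x)                     ≡⟨ simplify α (S x) ⟩
        (- α) * S x                               ≈⟨ *-distribˡ-sum (- α) (λ i → c (suc i) * v i x) ⟩
        ∑[ i < m ] ((- α) * (c (suc i) * v i x))  ≈⟨ sum-cong-≋ (λ i → ≈-reflexive (reassoc α (c (suc i)) (v i x))) ⟩
        ∑[ i < m ] (- (α * c (suc i)) * v i x)    ∎
        where
        α : ℤ
        α = proj₁ (inverse (c zero) c₀≉0)
        c₀α≈1 : c zero * α ≈ + 1
        c₀α≈1 = proj₂ (inverse (c zero) c₀≉0)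
        isolate : ∀ c α f s → c * α * f ≡ α * (c * f + s) + - (α * s)
        isolate = solve-∀
        simplify : ∀ α s → α * + 0 + - (α * s) ≡ (- α) * s
        simplify = solve-∀
        reassoc : ∀ α c v → (- α) * (c * v) ≡ - (α * c) * v
        reassoc = solve-∀
      c₀≈0 : c zero ≈ + 0
      c₀≈0 = decidable-stable (≈? (c zero) (+ 0)) (f∉⟨v⟩ ∘ f∈⟨v⟩)
      S≈0 : ∀ x → S x ≈ + 0
      S≈0 x = begin
        S x                                  ≡⟨ isolate (c zero * f x) (S x) ⟩
        (c zero * f x + S x) - c zero * f x  ≈⟨ +-cong (combo≈0 x) (-‿cong (*-congʳ (f x) c₀≈0)) ⟩
        + 0 - + 0 * f x                      ≡⟨ cancel (f x) ⟩
        + 0                                  ∎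
        where isolate : ∀ a s → s ≡ (a + s) - a
              isolate = solve-∀
              cancel : ∀ f → + 0 - + 0 * f ≡ + 0
              cancel = solve-∀
      coefficient≈0 : ∀ i → c i ≈ + 0
      coefficient≈0 zero    = c₀≈0
      coefficient≈0 (suc i) = indep (c ∘ suc) S≈0 i

    ∈⟨⟩-tail : ∀ {r} {u : Fin (suc r) → X → ℤ} {f} c → (∀ x → f x ≈ ∑[ i < suc r ] (c i * u i x)) →
               c zero ≈ + 0 → f ∈⟨ tail u ⟩
    ∈⟨⟩-tail {r} {u} {f} c f≈cu c₀≈0 = c ∘ suc , λ x → begin
      f x                                                       ≈⟨ f≈cu x ⟩
      c zero * u zero x + ∑[ i < r ] (c (suc i) * u (suc i) x)  ≈⟨ +-congʳ (∑[ i < r ] (c (suc i) * u (suc i) x)) (*-congʳ (u zero x) c₀≈0) ⟩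
      + 0 * u zero x + ∑[ i < r ] (c (suc i) * u (suc i) x)     ≡⟨ ℤ.+-identityˡ _ ⟩
      ∑[ i < r ] (c (suc i) * u (suc i) x)                      ∎

    -- Gaussian elimination of u₀ using a row w j₀ whose u₀-coefficient is invertible.
    module Elimination {m r} (u : Fin (suc r) → X → ℤ) (w : Fin (suc m) → X → ℤ)
                       (d : Fin (suc m) → Fin (suc r) → ℤ)
                       (w≈du : ∀ j x → w j x ≈ ∑[ i < suc r ] (d j i * u i x))
                       (j₀ : Fin (suc m)) (α : ℤ) (pivot : d j₀ zero * α ≈ + 1) where

      β : Fin m → ℤ
      β j = d (punchIn j₀ j) zero * α

      w′ : Fin m → X → ℤ
      w′ j x = w (punchIn j₀ j) x - β j * w j₀ x

      w′∈⟨tail-u⟩ : ∀ j → w′ j ∈⟨ tail u ⟩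
      w′∈⟨tail-u⟩ j = e , λ x → let U = u zero x; S₁ = S (punchIn j₀ j) x; S₂ = S j₀ x in begin
        w′ j x                                         ≈⟨ +-cong (w≈du (punchIn j₀ j) x) (-‿cong (*-congˡ (β j) (w≈du j₀ x))) ⟩
        (D * U + S₁) - β j * (E * U + S₂)              ≡⟨ regroup D α U E S₁ S₂ ⟩
        D * U * (+ 1 - E * α) + (S₁ + - β j * S₂)      ≈⟨ +-congʳ (S₁ + - β j * S₂) (*-congˡ (D * U) (+-congˡ (+ 1) (-‿cong pivot))) ⟩
        D * U * (+ 1 - + 1) + (S₁ + - β j * S₂)        ≡⟨ vanish (D * U) (S₁ + - β j * S₂) ⟩
        S₁ + - β j * S₂                                ≈⟨ +-congˡ S₁ (*-distribˡ-sum (- β j) (λ i → d j₀ (suc i) * u (suc i) x)) ⟩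
        S₁ + ∑[ i < r ] (- β j * (d j₀ (suc i) * u (suc i) x))
          ≈⟨ ≈-sym (∑-distrib-+ (λ i → d (punchIn j₀ j) (suc i) * u (suc i) x) (λ i → - β j * (d j₀ (suc i) * u (suc i) x))) ⟩
        ∑[ i < r ] (d (punchIn j₀ j) (suc i) * u (suc i) x + - β j * (d j₀ (suc i) * u (suc i) x))
          ≈⟨ sum-cong-≋ (λ i → ≈-reflexive (factor (d (punchIn j₀ j) (suc i)) (β j) (d j₀ (suc i)) (u (suc i) x))) ⟩
        ∑[ i < r ] (e i * u (suc i) x)                 ∎
        where
        D E : ℤ
        D = d (punchIn j₀ j) zero
        E = d j₀ zero
        S : Fin (suc m) → X → ℤ
        S j x = ∑[ i < r ] (d j (suc i) * u (suc i) x)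
        e : Fin r → ℤ
        e i = d (punchIn j₀ j) (suc i) - β j * d j₀ (suc i)
        regroup : ∀ D α U E s₁ s₂ → (D * U + s₁) - D * α * (E * U + s₂) ≡ D * U * (+ 1 - E * α) + (s₁ + - (D * α) * s₂)
        regroup = solve-∀
        vanish : ∀ a s → a * (+ 1 - + 1) + s ≡ s
        vanish = solve-∀
        factor : ∀ a b c u → a * u + - b * (c * u) ≡ (a - b * c) * u
        factor = solve-∀

      w′-independent : Independent w → Independent w′
      w′-independent indep c′ combo≈0 j =
        subst (_≈ + 0) (insertAt-punchIn c′ j₀ γ j) (indep c combo′≈0 (punchIn j₀ j))
        where
        γ : ℤ
        γ = ∑[ j < m ] (- (c′ j * β j))
        c : Fin (suc m) → ℤ
        c = insertAt c′ j₀ γ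
        combo′≈0 : ∀ x → ∑[ i < suc m ] (c i * w i x) ≈ + 0
        combo′≈0 x = let W = w j₀ x; A = ∑[ j < m ] (c′ j * w (punchIn j₀ j) x) in begin
          ∑[ i < suc m ] (c i * w i x)                               ≈⟨ sum-remove {i = j₀} (λ i → c i * w i x) ⟩
          c j₀ * W + ∑[ j < m ] (c (punchIn j₀ j) * w (punchIn j₀ j) x)
            ≡⟨ cong₂ _+_ (cong (_* W) (insertAt-lookup c′ j₀ γ))
                         (sum-cong-≗ (λ j → cong (_* w (punchIn j₀ j) x) (insertAt-punchIn c′ j₀ γ j))) ⟩
          γ * W + A                                                  ≡⟨ ℤ.+-comm (γ * W) A ⟩
          A + γ * W                                                  ≈⟨ +-congˡ A (*-distribʳ-sum W (λ j → - (c′ j * β j))) ⟩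
          A + ∑[ j < m ] (- (c′ j * β j) * W)
            ≈⟨ ≈-sym (∑-distrib-+ (λ j → c′ j * w (punchIn j₀ j) x) (λ j → - (c′ j * β j) * W)) ⟩
          ∑[ j < m ] (c′ j * w (punchIn j₀ j) x + - (c′ j * β j) * W)
            ≈⟨ sum-cong-≋ (λ j → ≈-reflexive (factor (c′ j) (w (punchIn j₀ j) x) (β j) W)) ⟩
          ∑[ j < m ] (c′ j * w′ j x)                                 ≈⟨ combo≈0 x ⟩
          + 0                                                        ∎
          where factor : ∀ c a b w → c * a + - (c * b) * w ≡ c * (a - b * w)
                factor = solve-∀

    steinitz : ∀ r {m} (u : Fin r → X → ℤ) (w : Fin m → X → ℤ) → Independent w → (∀ j → w j ∈⟨ u ⟩) → m ≤ r
    steinitz zero    {zero}  u w indep w∈⟨u⟩ = z≤n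
    steinitz zero    {suc m} u w indep w∈⟨u⟩ = ⊥-elim (1≉0 (indep (+ 1 ∷ λ _ → + 0) w₀≈0 zero))
      where
      w₀≈0 : ∀ x → + 1 * w zero x + ∑[ i < m ] (+ 0 * w (suc i) x) ≈ + 0
      w₀≈0 x = begin
        + 1 * w zero x + ∑[ i < m ] (+ 0 * w (suc i) x) ≈⟨ +-cong (≈-reflexive (ℤ.*-identityˡ (w zero x))) (sum-replicate-zero m) ⟩
        w zero x + + 0                                  ≡⟨ ℤ.+-identityʳ (w zero x) ⟩
        w zero x                                        ≈⟨ proj₂ (w∈⟨u⟩ zero) x ⟩
        + 0                                             ∎
    steinitz (suc r) {zero}  u w indep w∈⟨u⟩ = z≤n
    steinitz (suc r) {suc m} u w indep w∈⟨u⟩ with any? (λ j → ¬? (≈? (proj₁ (w∈⟨u⟩ j) zero) (+ 0)))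
    ... | no  no-pivot = ℕ.m≤n⇒m≤1+n (steinitz r (tail u) w indep λ j →
      ∈⟨⟩-tail {u = u} (proj₁ (w∈⟨u⟩ j)) (proj₂ (w∈⟨u⟩ j)) (decidable-stable (≈? _ _) (λ d≉0 → no-pivot (j , d≉0))))
    ... | yes (j₀ , d≉0) = s≤s (steinitz r (tail u) w′ (w′-independent indep) w′∈⟨tail-u⟩)
      where open Elimination u w (proj₁ ∘ w∈⟨u⟩) (proj₂ ∘ w∈⟨u⟩) j₀ (proj₁ (inverse _ d≉0)) (proj₂ (inverse _ d≉0))

  ∈⟨⟩? : ∀ {n a m} (v : Fin m → (Fin n → Fin a) → ℤ) g →
         (∀ i → v i Preserves _≗_ ⟶ _≡_) → g Preserves _≗_ ⟶ _≡_ → Dec (g ∈⟨ v ⟩)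
  ∈⟨⟩? {m = m} v g v-ext g-ext =
    map′ (λ (c , g≈cv) → ι ∘ c , g≈cv)
         (λ (c , g≈cv) → reduce ∘ c , λ x → ≈-trans (g≈cv x) (sum-cong-≋ (λ i → *-congʳ (v i x) (≈-sym (ι-reduce (c i))))))
         (any-function? coefficients-ext (λ c → all-functions? (points-ext c) (λ x → ≈? (g x) (combo c x))))
    where
    combo : (Fin m → Fin p) → _ → ℤ
    combo c x = ∑[ i < m ] (ι (c i) * v i x)
    points-ext : ∀ c → (λ x → g x ≈ combo c x) Respects _≗_
    points-ext c x≗y = subst₂ _≈_ (g-ext x≗y) (sum-cong-≗ (λ i → cong (ι (c i) *_) (v-ext i x≗y)))
    coefficients-ext : (λ c → ∀ x → g x ≈ combo c x) Respects _≗_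
    coefficients-ext c≗c′ g≈cv x = subst (g x ≈_) (sum-cong-≗ (λ i → cong (λ t → ι t * v i x) (c≗c′ i))) (g≈cv x)

  module _ {Row X : Set} (g : Row → X → ℤ) where

    record MaximalIndependent : Set where
      field
        rank        : ℕ
        rows        : Fin rank → Row
        independent : Independent (g ∘ rows)
        spanning    : ∀ r → g r ∈⟨ g ∘ rows ⟩

    -- Extend an independent family by any row outside its span, until the bound B forbids it.
    maximal-independent : ∀ B → (∀ {m} (rows : Fin m → Row) → Independent (g ∘ rows) → m ≤ B) →
      (∀ {m} (rows : Fin m → Row) → (∀ r → g r ∈⟨ g ∘ rows ⟩) ⊎ ∃ (λ r → ¬ g r ∈⟨ g ∘ rows ⟩)) →
      MaximalIndependent
    maximal-independent B bounded spans-or-escapes = extend (suc B) {0} (λ ()) (λ _ _ ()) (ℕ.n<1+n B)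
      where
      extend : ∀ fuel {m} (rows : Fin m → Row) → Independent (g ∘ rows) → B < m ℕ.+ fuel → MaximalIndependent
      extend zero {m} rows indep B<m = ⊥-elim (ℕ.<⇒≱ (subst (B <_) (ℕ.+-identityʳ m) B<m) (bounded rows indep))
      extend (suc fuel) {m} rows indep B<m+1+fuel with spans-or-escapes rows
      ... | inj₁ spanning = record { rows = rows ; independent = indep ; spanning = spanning }
      ... | inj₂ (r , r∉) = extend fuel (r ∷ rows) (Independent-resp cons-∘ (Independent-∷ indep r∉))
                                   (subst (B <_) (ℕ.+-suc m fuel) B<m+1+fuel)
        where cons-∘ : ∀ i x → (g r ∷ g ∘ rows) i x ≡ g ((r ∷ rows) i) x
              cons-∘ zero    x = refl
              cons-∘ (suc i) x = refl

    module _ (M : MaximalIndependent) where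

      open MaximalIndependent M

      maximal⇒HasRank : HasRank p g rank
      maximal⇒HasRank = (rows , Independent⇒LinIndep independent) , λ m rows′ indep′ →
        steinitz rank (g ∘ rows) (g ∘ rows′) (LinIndep⇒Independent indep′) (λ j → spanning (rows′ j))

      maximal⇒IsDim : (S : (X → ℤ) → Set) → (∀ i → S (g (rows i))) →
                      (∀ f → S f → ∃ λ m → ∃ λ (rows′ : Fin m → Row) → f ∈⟨ g ∘ rows′ ⟩) → IsDim p S rank
      maximal⇒IsDim S rows∈S S⊆⟨g⟩ = g ∘ rows , rows∈S , Independent⇒LinIndep independent , λ f f∈S →
        let (_ , rows′ , f∈⟨rows′⟩) = S⊆⟨g⟩ f f∈S in ∈⟨⟩⇒InSpan (∈⟨⟩-trans f∈⟨rows′⟩ (λ j → spanning (rows′ j)))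

module Hyperplanes {p : ℕ} (prime : Prime p) (k n : ℕ) where

  open import Defs
  open import Data.Nat as ℕ using (ℕ; zero; suc; _^_; _∸_; _≤_; _<_; s≤s; z≤n)
  import Data.Nat.Properties as ℕ
  open import Data.Nat.Primality using (Prime; prime⇒nonZero)
  open import Data.Nat.Combinatorics using (_C_)
  open import Data.Integer as ℤ using (ℤ; +_; _-_; _*_; _+_)
  import Data.Integer.Properties as ℤ
  import Data.Nat.Divisibility
  open import Data.Integer.Divisibility.Signed using (_∣?_; divides; ∣m+n∣n⇒∣m; ∣m∣n⇒∣m+n)
  open import Data.Integer.Tactic.RingSolver using (solve-∀)
  open import Data.Fin using (Fin; zero; suc; toℕ)
  open import Data.Fin.Properties using (all?; any?)
  open import Data.Vec.Functional using (head; tail)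
  import Algebra.Properties.Semiring.Sum as SemiringSum
  open import Data.Product using (∃; _×_; _,_; proj₁; proj₂)
  open import Data.Sum using (_⊎_; inj₁; inj₂)
  open import Relation.Binary.Core using (_Preserves_⟶_)
  open import Relation.Binary.Definitions using (_Respects_)
  open import Data.Empty using (⊥-elim)
  open import Function using (_∘_)
  open import Relation.Nullary using (¬_; Dec; yes; no)
  open import Relation.Nullary.Decidable using (_×-dec_; _→-dec_; ¬?; decidable-stable)
  open import Relation.Binary.PropositionalEquality using (_≡_; _≗_; refl; sym; trans; cong; cong₂; subst; module ≡-Reasoning)
  open Binomial using (p∣[p^k]Cj)
  open FiniteDifferences
  open BinomialMonomials
  open FiniteSearch

  private instance _ = prime⇒nonZero prime
  open Congruence p
  open LinearAlgebra prime
  open Degree p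
  open Spanning p

  q : ℕ
  q = p ^ k

  q≡1+[q∸1] : q ≡ suc (q ∸ 1)
  q≡1+[q∸1] = trans (sym (ℕ.m∸n+n≡m (ℕ.m^n>0 p k))) (ℕ.+-comm (q ∸ 1) 1)

  χ : ℤ → ℤ
  χ z with + q ∣? z
  ... | yes _ = + 1
  ... | no  _ = + 0

  χ-+multiple : ∀ z w → χ (z + w * + q) ≡ χ z
  χ-+multiple z w with + q ∣? (z + w * + q) | + q ∣? z
  ... | yes _     | yes _    = refl
  ... | no  _     | no  _    = refl
  ... | yes q∣z+wq | no  q∤z = ⊥-elim (q∤z (∣m+n∣n⇒∣m q∣z+wq (divides w refl)))
  ... | no  q∤z+wq | yes q∣z = ⊥-elim (q∤z+wq (∣m∣n⇒∣m+n q∣z (divides w refl)))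

  𝟏H≡χ : ∀ a b x → 𝟏H p k n a b x ≡ χ (∑[ i < n ] ((ι (x i) - ι (a i)) * ι (b i)))
  𝟏H≡χ a b x = trans (unfold a b x) (cong χ (trans (ℤ.+-identityʳ (∑ f)) (∑≡sum f)))
    where
    f : Fin n → ℤ
    f i = (ι (x i) - ι (a i)) * ι (b i)
    unfold : ∀ a b x → 𝟏H p k n a b x ≡ χ (∑ (λ i → (ι (x i) - ι (a i)) * ι (b i)) - + 0)
    unfold a b x with + q ∣? (∑ (λ i → (ι (x i) - ι (a i)) * ι (b i)) - + 0)
    ... | yes _ = refl
    ... | no  _ = refl

  ∑[y-a]b≡⟨y,b⟩-⟨a,b⟩ : ∀ {m} (y a b : Fin m → ℕ) → ∑[ i < m ] ((+ y i - + a i) * + b i) ≡ + ⟨ y , b ⟩ - + ⟨ a , b ⟩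
  ∑[y-a]b≡⟨y,b⟩-⟨a,b⟩ {zero}  y a b = refl
  ∑[y-a]b≡⟨y,b⟩-⟨a,b⟩ {suc m} y a b = begin
    (+ y₀ - + a₀) * + b₀ + ∑[ i < m ] ((+ tail y i - + tail a i) * + tail b i)
      ≡⟨ cong (λ t → (+ y₀ - + a₀) * + b₀ + t) (∑[y-a]b≡⟨y,b⟩-⟨a,b⟩ (tail y) (tail a) (tail b)) ⟩
    (+ y₀ - + a₀) * + b₀ + (+ ⟨ tail y , tail b ⟩ - + ⟨ tail a , tail b ⟩)
      ≡⟨ regroup (+ y₀) (+ a₀) (+ b₀) (+ ⟨ tail y , tail b ⟩) (+ ⟨ tail a , tail b ⟩) ⟩
    (+ y₀ * + b₀ + + ⟨ tail y , tail b ⟩) - (+ a₀ * + b₀ + + ⟨ tail a , tail b ⟩)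
      ≡⟨ cong₂ _-_ (pos-*+ y₀ b₀ _) (pos-*+ a₀ b₀ _) ⟩
    + ⟨ y , b ⟩ - + ⟨ a , b ⟩ ∎
    where
    open ≡-Reasoning
    y₀ a₀ b₀ : ℕ
    y₀ = head y
    a₀ = head a
    b₀ = head b
    regroup : ∀ y a b s t → (y - a) * b + (s - t) ≡ (y * b + s) - (a * b + t)
    regroup = solve-∀
    pos-*+ : ∀ u v w → + u * + v + + w ≡ + (u ℕ.* v ℕ.+ w)
    pos-*+ u v w = trans (cong (_+ + w) (sym (ℤ.pos-* u v))) (sym (ℤ.pos-+ (u ℕ.* v) w))

  φ : ℕ → ℤ
  φ t = χ (+ t)

  -- Adding q·⟨a,b⟩ to ⟨x,b⟩ - ⟨a,b⟩ moves the argument of χ into ℕ.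
  𝟏H≡φ : ∀ a b x → 𝟏H p k n a b x ≡ φ ((q ∸ 1) ℕ.* ⟨ toℕ ∘ a , toℕ ∘ b ⟩ ℕ.+ ⟨ toℕ ∘ x , toℕ ∘ b ⟩)
  𝟏H≡φ a b x = begin
    𝟏H p k n a b x                ≡⟨ 𝟏H≡χ a b x ⟩
    χ (∑[ i < n ] ((ι (x i) - ι (a i)) * ι (b i))) ≡⟨ cong χ (∑[y-a]b≡⟨y,b⟩-⟨a,b⟩ (toℕ ∘ x) (toℕ ∘ a) (toℕ ∘ b)) ⟩
    χ (+ L - + A)                 ≡⟨ χ-+multiple (+ L - + A) (+ A) ⟨
    χ (+ L - + A + + A * + q)     ≡⟨ cong χ eq ⟩
    χ (+ ((q ∸ 1) ℕ.* A ℕ.+ L))   ∎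
    where
    open ≡-Reasoning
    L A : ℕ
    L = ⟨ toℕ ∘ x , toℕ ∘ b ⟩
    A = ⟨ toℕ ∘ a , toℕ ∘ b ⟩
    shift : ∀ L A r → (L - A) + A * (+ 1 + r) ≡ r * A + L
    shift = solve-∀
    eq : + L - + A + + A * + q ≡ + ((q ∸ 1) ℕ.* A ℕ.+ L)
    eq = trans (cong (λ m → + L - + A + + A * + m) q≡1+[q∸1])
               (trans (shift (+ L) (+ A) (+ (q ∸ 1)))
                      (trans (cong (_+ + L) (sym (ℤ.pos-* (q ∸ 1) A))) (sym (ℤ.pos-+ ((q ∸ 1) ℕ.* A) L))))

  φ-periodic : ∀ t → φ (t ℕ.+ suc (q ∸ 1)) ≡ φ t
  φ-periodic t = begin
    χ (+ (t ℕ.+ suc (q ∸ 1)))  ≡⟨ cong (λ m → χ (+ (t ℕ.+ m))) q≡1+[q∸1] ⟨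
    χ (+ (t ℕ.+ q))            ≡⟨ cong χ (trans (ℤ.pos-+ t q) (cong (λ s → + t + s) (sym (ℤ.*-identityˡ (+ q))))) ⟩
    χ (+ t + + 1 * + q)        ≡⟨ χ-+multiple (+ t) (+ 1) ⟩
    χ (+ t)                    ∎
    where open ≡-Reasoning

  φ-hasDegree : HasDegree≤ (q ∸ 1) φ
  φ-hasDegree = Δ^≈0⇒HasDegree≤ (q ∸ 1) φ (periodic⇒Δ^period≈0 (q ∸ 1) φ φ-periodic p∣C)
    where
    p∣C : ∀ j → j < q ∸ 1 → + (suc (q ∸ 1) C suc j) ≈ + 0
    p∣C j j<q∸1 = ∣⇒≈0 (subst (λ m → p Data.Nat.Divisibility.∣ m C suc j) q≡1+[q∸1]
                               (p∣[p^k]Cj prime k (suc j) (s≤s z≤n) (subst (suc j <_) (sym q≡1+[q∸1]) (s≤s j<q∸1))))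

  monomials : Fin (monomialCount n (q ∸ 1)) → Pt p k n → ℤ
  monomials i x = binomialMonomials n (q ∸ 1) i (toℕ ∘ x)

  𝟏H∈⟨monomials⟩ : ∀ a b → 𝟏H p k n a b ∈⟨ monomials ⟩
  𝟏H∈⟨monomials⟩ a b = ∈⟨⟩-resp (λ x → sym (𝟏H≡φ a b x)) (∈⟨⟩-∘ (toℕ ∘_)
    (binomialMonomials-span n (q ∸ 1) φ φ-hasDegree (toℕ ∘ b) ((q ∸ 1) ℕ.* ⟨ toℕ ∘ a , toℕ ∘ b ⟩)))

  Row : Set
  Row = Pt p k n × Direction p k n

  independent-rows-bounded : ∀ {m} (rows : Fin m → Row) → Independent (𝒜* p k n ∘ rows) → m ≤ monomialCount n (q ∸ 1)
  independent-rows-bounded rows indep =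
    steinitz _ monomials (𝒜* p k n ∘ rows) indep (λ j → 𝟏H∈⟨monomials⟩ (proj₁ (rows j)) (proj₁ (proj₂ (rows j))))

  𝟏H-cong : ∀ {a a′ b b′ x x′} → a ≗ a′ → b ≗ b′ → x ≗ x′ → 𝟏H p k n a b x ≡ 𝟏H p k n a′ b′ x′
  𝟏H-cong {a} {a′} {b} {b′} {x} {x′} a≗a′ b≗b′ x≗x′ = begin
    𝟏H p k n a b x                                      ≡⟨ 𝟏H≡χ a b x ⟩
    χ (∑[ i < n ] ((ι (x i) - ι (a i)) * ι (b i)))
      ≡⟨ cong χ (sum-cong-≗ (λ i → cong₂ _*_ (cong₂ _-_ (cong ι (x≗x′ i)) (cong ι (a≗a′ i))) (cong ι (b≗b′ i)))) ⟩
    χ (∑[ i < n ] ((ι (x′ i) - ι (a′ i)) * ι (b′ i)))    ≡⟨ 𝟏H≡χ a′ b′ x′ ⟨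
    𝟏H p k n a′ b′ x′                                   ∎
    where open ≡-Reasoning

  IsUnit? : ∀ r → Dec (IsUnit p k r)
  IsUnit? r = any? (λ s → + q ∣? (ι r * ι s - + 1))

  Normalized? : ∀ b → Dec (Normalized p k n b)
  Normalized? b = any? (λ i → all? (λ j → (toℕ j ℕ.<? toℕ i) →-dec ¬? (IsUnit? (b j))) ×-dec (+ q ∣? (ι (b i) - + 1)))

  Normalized-resp : Normalized p k n Respects _≗_
  Normalized-resp b≗b′ (i , no-unit-before , bᵢ≡1) =
    i , (λ j j<i unit → no-unit-before j j<i (subst (IsUnit p k) (sym (b≗b′ j)) unit)) ,
    subst (λ r → ι r ≡[ q ] (+ 1)) (b≗b′ i) bᵢ≡1

  𝟏H-preserves-≗ : ∀ a b → 𝟏H p k n a b Preserves _≗_ ⟶ _≡_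
  𝟏H-preserves-≗ a b = 𝟏H-cong {a} {a} {b} {b} (λ _ → refl) (λ _ → refl)

  module _ {m} (rows : Fin m → Row) where

    private
      V : Fin m → Pt p k n → ℤ
      V = 𝒜* p k n ∘ rows

      ∈⟨V⟩? : ∀ a b → Dec (𝟏H p k n a b ∈⟨ V ⟩)
      ∈⟨V⟩? a b = ∈⟨⟩? V (𝟏H p k n a b) (λ i → 𝟏H-preserves-≗ (proj₁ (rows i)) (proj₁ (proj₂ (rows i)))) (𝟏H-preserves-≗ a b)

      Escape : Pt p k n → Pt p k n → Set
      Escape a b = Normalized p k n b × ¬ 𝟏H p k n a b ∈⟨ V ⟩

      Escape-respʳ : ∀ a → Escape a Respects _≗_
      Escape-respʳ a {b} {b′} b≗b′ (nb , ∉) = Normalized-resp b≗b′ nb , λ ∈ → ∉ (∈⟨⟩-resp (λ x →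
        𝟏H-cong {a} {a} {b′} {b} {x} {x} (λ _ → refl) (sym ∘ b≗b′) (λ _ → refl)) ∈)

      Escape-respˡ : (λ a → ∃ (Escape a)) Respects _≗_
      Escape-respˡ {a} {a′} a≗a′ (b , nb , ∉) = b , nb , λ ∈ → ∉ (∈⟨⟩-resp (λ x →
        𝟏H-cong {a′} {a} {b} {b} {x} {x} (sym ∘ a≗a′) (λ _ → refl) (λ _ → refl)) ∈)

      escape? : Dec (∃ λ a → ∃ (Escape a))
      escape? = any-function? Escape-respˡ (λ a → any-function? (Escape-respʳ a) (λ b → Normalized? b ×-dec ¬? (∈⟨V⟩? a b)))

    spanned-or-escape : (∀ r → 𝒜* p k n r ∈⟨ V ⟩) ⊎ ∃ (λ r → ¬ 𝒜* p k n r ∈⟨ V ⟩)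
    spanned-or-escape = decide escape?
      where
      decide : Dec (∃ λ a → ∃ (Escape a)) → (∀ r → 𝒜* p k n r ∈⟨ V ⟩) ⊎ ∃ (λ r → ¬ 𝒜* p k n r ∈⟨ V ⟩)
      decide (yes (a , b , nb , ∉)) = inj₂ ((a , b , nb) , ∉)
      decide (no none)              = inj₁ λ (a , b , nb) → decidable-stable (∈⟨V⟩? a b) (λ ∉ → none (a , b , nb , ∉))

  𝒜*-row∈𝓗 : ∀ r → 𝓗 p k n (𝒜* p k n r)
  𝒜*-row∈𝓗 r = 1 , (λ _ → proj₁ r) , (λ _ → proj₂ r) , (λ _ → + 1) , λ x → ≈-elim (≈-reflexive (unit (𝒜* p k n r x)))
    where unit : ∀ a → a ≡ + 1 * a + + 0
          unit = solve-∀

  𝓗⊆⟨𝒜*⟩ : ∀ f → 𝓗 p k n f → ∃ λ m → ∃ λ (rows : Fin m → Row) → f ∈⟨ 𝒜* p k n ∘ rows ⟩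
  𝓗⊆⟨𝒜*⟩ f (m , a , b , c , f≡cH) = m , (λ i → a i , b i) , InSpan⇒∈⟨⟩ (c , f≡cH)

  𝒜*-maximal : MaximalIndependent (𝒜* p k n)
  𝒜*-maximal = maximal-independent (𝒜* p k n) (monomialCount n (q ∸ 1)) independent-rows-bounded spanned-or-escape

open import Defs
open BinomialMonomials using (monomialCount≡C)
open import Data.Nat using (_^_; _∸_; _+_; _≤_)
open import Data.Nat.Combinatorics using (_C_)
open import Data.Product using (∃; _×_; _,_)
open import Relation.Binary.PropositionalEquality using (subst)
open import Function using (_∘_)

theorem1p3 : ∀ (p k n : ℕ) → Prime p →
    ∃ λ (d : ℕ) →
    IsDim p (𝓗 p k n) d × HasRank p (𝒜* p k n) d × d ≤ ((p ^ k ∸ 1 + n) C n)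
theorem1p3 p k n p-prime =
    rank
  , maximal⇒IsDim (𝒜* p k n) 𝒜*-maximal (𝓗 p k n) (𝒜*-row∈𝓗 ∘ rows) 𝓗⊆⟨𝒜*⟩
  , maximal⇒HasRank (𝒜* p k n) 𝒜*-maximal
  , subst (rank ≤_) (monomialCount≡C n (p ^ k ∸ 1)) (independent-rows-bounded rows independent)
  where
  open Hyperplanes p-prime k n
  open LinearAlgebra p-prime
  open MaximalIndependent 𝒜*-maximal
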